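{- Let $\langle V,S\rangle$ be a program over a signature $\Sigma$ with largest priority $n$, and let $\mathbb P$ be a path in a (possibly infinite) derivation in the infinitary generational typing system, from $\bar z^\alpha:\omega\vdash_\Omega P::(w^\beta:C)$ up to $\bar x^\gamma:\omega'\vdash_{\Omega'}P'::(y^\delta:C')$. Then for all channels $u,v$, generations $\eta,\eta'\in\mathbb N$ and priorities $i,j\le n$: (a) if $u^\eta_i<_\Omega v^{\eta'}_j$ then $u^\eta_i<_{\Omega'}v^{\eta'}_j$; (b) if $u^\eta_i\le_\Omega v^{\eta'}_j$ then $u^\eta_i\le_{\Omega'}v^{\eta'}_j$; (c) if $u^\eta_i=_\Omega v^{\eta'}_j$ then $u^\eta_i=_{\Omega'}v^{\eta'}_j$.
   Context: Signature $\Sigma$: finite set of definitions $t=^i_aA$ (polarity $a\in\{\mu,\nu\}$, priority $i$); $p(t)$ priority of $t$; $\mathtt c(A)$ the set of priorities of type variables reachable from type $A$ by unfolding definitions. Types $A::=\oplus\{\ell:A_\ell\}\mid\&\{\ell:A_\ell\}\mid1\mid t$. Processes: forward, cut $(x\leftarrow P_x;Q_x)$, label sends/receives, close/wait, unfolding messages $Rx.\mu_t;P$, $\mathbf{case}\,Lx(\mu_t\Rightarrow P)$, $\mathbf{case}\,Rx(\nu_t\Rightarrow P)$, $Lx.\nu_t;P$, calls $y\leftarrow X\leftarrow\bar x$; program $\langle V,S\rangle$ of process definitions. Generational judgments $\bar x^\alpha:\omega\vdash_\Omega P::(y^\beta:C)$: channels carry generations, $\Omega$ is a set of constraints $a<b$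 or $a=b$ between symbols $x^\alpha_i$; $a\le_\Omega b$ iff there is a chain of constraints of $\Omega$ from $a$ to $b$ (equations usable in both directions), $a<_\Omega b$ iff such a chain contains a strict step, $a=_\Omega b$ iff there is a chain of equations. Infinitary rules: Id; Cut: from $\bar x^\alpha:\omega\vdash_{\Omega\cup\mathtt r(y^\beta)}P_{w^0}::(w^0:A)$ and $w^0:A\vdash_{\Omega\cup\mathtt r(\bar x^\alpha)}Q_{w^0}::(y^\beta:C)$ infer the cut with $\Omega$, where $\mathtt r(v)=\{w^0_i=v_i:i\notin\mathtt c(A)\}$ and $w$ does not occur in $\Omega$; $\oplus,\&,1$ rules with $\Omega$ unchanged; $\mu R$ (send $\mu_t$ on right channel $y^\beta$): premise with $y^{\beta+1}$ and $\Omega\cup\{y^\beta_j=y^{\beta+1}_j:j\ne p(t)\}$; $\mu L$ (receive $\mu_t$ on left $x^\alpha$): premise with $x^{\alpha+1}$ and $\Omega\cup\{x^{\alpha+1}_{p(t)}<x^\alpha_{p(t)}\}\cup\{x^{\alpha+1}_j=x^\alpha_j:j\ne p(t)\}$; $\nu R$ (receive $\nu_t$ on right $y^\beta$): premise with $y^{\beta+1}$ and $\Omega\cup\{y^{\beta+1}_{p(t)}<y^\beta_{p(t)}\}\cup\{y^{\beta+1}_j=y^\beta_j:j\ne p(t)\}$; $\nu L$ (send $\nu_t$ on left $x^\alpha$): premise with $x^{\alpha+1}$ and $\Omega\cup\{x^{\alpha+1}_j=x^\alpha_j:j\ne p(t)\}$; new generations never occur in $\Omega$; Def$(X)$: replaces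 a call by the definition body of $X$ in $V$, $\Omega$ unchanged. A path is a sequence of judgments each a premise of the rule concluding the previous one. -}

module Defs where

open import Data.Nat using (ℕ; zero; suc; _≤_; _⊔_; _≡ᵇ_)
open import Data.Bool using (if_then_else_)
open import Data.Product using (Σ; ∃; ∃₂; _×_; _,_; proj₁; proj₂)
open import Data.Sum using (_⊎_)
open import Data.List using (List; []; _∷_; map; foldr; zipWith; length; zip)
open import Data.List.Membership.Propositional using (_∈_)
open import Data.List.Relation.Unary.All as All using (All)
open import Relation.Binary.PropositionalEquality using (_≡_; _≢_)
open import Relation.Nullary using (¬_)

Chan : Set
Chan = ℕ
Label : Set
Label = ℕ
TName : Set
TName = ℕ
PName : Set
PName = ℕ

data Pol : Set where
  μ ν : Pol

data Tp : Set where
  ⊕_ : List (Label × Tp) → Tp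
  &_ : List (Label × Tp) → Tp
  𝟙  : Tp
  tv : TName → Tp

record TDef : Set where
  constructor tdef
  field
    name : TName
    pol  : Pol
    pri  : ℕ
    body : Tp

Signature : Set
Signature = List TDef

maxPri : Signature → ℕ
maxPri = foldr (λ d m → TDef.pri d ⊔ m) 0

data Occurs (t : TName) : Tp → Set where
  o-var : Occurs t (tv t)
  o-⊕   : ∀ {As ℓ B} → (ℓ , B) ∈ As → Occurs t B → Occurs t (⊕ As)
  o-&   : ∀ {As ℓ B} → (ℓ , B) ∈ As → Occurs t B → Occurs t (& As)

data Reach (Sg : Signature) : Tp → TName → Set where
  r-occ : ∀ {A t} → Occurs t A → Reach Sg A t
  r-unf : ∀ {A t' a i B t} → Occurs t' A → tdef t' a i B ∈ Sg →
          Reach Sg B t → Reach Sg A t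

c : Signature → Tp → ℕ → Set
c Sg A i = ∃ λ t → Reach Sg A t × ∃₂ λ a B → tdef t a i B ∈ Sg

-- Processes (named syntax; only cut binds a channel)

data Proc : Set where
  fwd    : Chan → Chan → Proc
  cut    : Chan → Proc → Proc → Proc
  sendR  : Chan → Label → Proc → Proc
  caseL  : Chan → List (Label × Proc) → Proc
  caseR  : Chan → List (Label × Proc) → Proc
  sendL  : Chan → Label → Proc → Proc
  closeR : Chan → Proc
  waitL  : Chan → Proc → Proc
  μR     : Chan → TName → Proc → Proc
  μL     : Chan → TName → Proc → Proc
  νR     : Chan → TName → Proc → Proc
  νL     : Chan → TName → Proc → Proc
  call   : Chan → PName → List Chan → Proc

-- renaming of free channels (the bound channel of a cut is not renamed)
except : (Chan → Chan) → Chan → (Chan → Chan)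
except σ x z = if z ≡ᵇ x then x else σ z

mutual
  ren : (Chan → Chan) → Proc → Proc
  ren σ (fwd y x)      = fwd (σ y) (σ x)
  ren σ (cut x P Q)    = cut x (ren (except σ x) P) (ren (except σ x) Q)
  ren σ (sendR y k P)  = sendR (σ y) k (ren σ P)
  ren σ (caseL x bs)   = caseL (σ x) (renBs σ bs)
  ren σ (caseR y bs)   = caseR (σ y) (renBs σ bs)
  ren σ (sendL x k P)  = sendL (σ x) k (ren σ P)
  ren σ (closeR y)     = closeR (σ y)
  ren σ (waitL x P)    = waitL (σ x) (ren σ P)
  ren σ (μR y t P)     = μR (σ y) t (ren σ P)
  ren σ (μL x t P)     = μL (σ x) t (ren σ P)
  ren σ (νR y t P)     = νR (σ y) t (ren σ P)
  ren σ (νL x t P)     = νL (σ x) t (ren σ P)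
  ren σ (call y X xs)  = call (σ y) X (map σ xs)

  renBs : (Chan → Chan) → List (Label × Proc) → List (Label × Proc)
  renBs σ []             = []
  renBs σ ((ℓ , P) ∷ bs) = (ℓ , ren σ P) ∷ renBs σ bs

subst1 : Chan → Chan → Proc → Proc
subst1 w x = ren (λ z → if z ≡ᵇ x then w else z)

paramRen : List (Chan × Chan) → Chan → Chan → Chan → Chan
paramRen []              y' y z = if z ≡ᵇ y' then y else z
paramRen ((x' , x) ∷ ps) y' y z = if z ≡ᵇ x' then x else paramRen ps y' y z

-- program ⟨V,S⟩: S declares  X : ω ⊢ C,  V defines  y' ← X ← x̄' = body
record Program : Set where
  field
    S : List (PName × List Tp × Tp)
    V : List (PName × List Chan × Chan × Proc)

record Sym : Set where
  constructor sym
  field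
    ch  : Chan
    gen : ℕ
    pri : ℕ

data Constraint : Set where
  _<ᶜ_ : Sym → Sym → Constraint
  _=ᶜ_ : Sym → Sym → Constraint

-- a (possibly infinite) set of constraints Ω
Cs : Set₁
Cs = Constraint → Set

_∪_ : Cs → Cs → Cs
(Ω ∪ Ω') k = Ω k ⊎ Ω' k
infixl 5 _∪_

data _≤[_]_ (a : Sym) (Ω : Cs) : Sym → Set where
  ≤-refl : a ≤[ Ω ] a
  ≤-eq→  : ∀ {b d} → a ≤[ Ω ] b → Ω (b =ᶜ d) → a ≤[ Ω ] d
  ≤-eq←  : ∀ {b d} → a ≤[ Ω ] b → Ω (d =ᶜ b) → a ≤[ Ω ] d
  ≤-lt   : ∀ {b d} → a ≤[ Ω ] b → Ω (b <ᶜ d) → a ≤[ Ω ] d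

data _<[_]_ (a : Sym) (Ω : Cs) : Sym → Set where
  chain< : ∀ {b b' d} → a ≤[ Ω ] b → Ω (b <ᶜ b') → b' ≤[ Ω ] d → a <[ Ω ] d

data _=[_]_ (a : Sym) (Ω : Cs) : Sym → Set where
  =-refl : a =[ Ω ] a
  =-eq→  : ∀ {b d} → a =[ Ω ] b → Ω (b =ᶜ d) → a =[ Ω ] d
  =-eq←  : ∀ {b d} → a =[ Ω ] b → Ω (d =ᶜ b) → a =[ Ω ] d

data SymMentions (x : Chan) (g : ℕ) : Sym → Set where
  here : ∀ {i} → SymMentions x g (sym x g i)

data MentionsGen (x : Chan) (g : ℕ) : Constraint → Set where
  l< : ∀ {a b} → SymMentions x g a → MentionsGen x g (a <ᶜ b)
  r< : ∀ {a b} → SymMentions x g b → MentionsGen x g (a <ᶜ b)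
  l= : ∀ {a b} → SymMentions x g a → MentionsGen x g (a =ᶜ b)
  r= : ∀ {a b} → SymMentions x g b → MentionsGen x g (a =ᶜ b)

data MentionsCh (x : Chan) : Constraint → Set where
  mc : ∀ {g k} → MentionsGen x g k → MentionsCh x k

NewGen : Chan → ℕ → Cs → Set
NewGen x g Ω = ∀ k → Ω k → ¬ MentionsGen x g k

FreshCh : Chan → Cs → Set
FreshCh w Ω = ∀ k → Ω k → ¬ MentionsCh w k

infix 4 _^_∶_
record Hyp : Set where
  constructor _^_∶_
  field
    ch  : Chan
    gen : ℕ
    ty  : Tp

infix 2 _⊢[_]_∷_
record Judg : Set₁ where
  constructor _⊢[_]_∷_
  field
    ctx  : List Hyp
    Ω    : Cs
    proc : Proc
    rhs  : Hyp

module Rules (Sg : Signature) (Pg : Program) where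
  open Program Pg

  n : ℕ
  n = maxPri Sg

  r : Tp → Chan → List Hyp → Cs
  r A w vs k = ∃ λ v → v ∈ vs × ∃ λ i → i ≤ n × ¬ c Sg A i ×
               k ≡ (sym w 0 i =ᶜ sym (Hyp.ch v) (Hyp.gen v) i)

  eqs : Chan → ℕ → ℕ → ℕ → Cs
  eqs x g g' p k = ∃ λ j → j ≤ n × j ≢ p × k ≡ (sym x g j =ᶜ sym x g' j)

  lt1 : Chan → ℕ → ℕ → ℕ → Cs
  lt1 x g g' p k = k ≡ (sym x g p <ᶜ sym x g' p)

  data Rule : Judg → List Judg → Set₁ where
    Id  : ∀ {x α A Ω y β} →
          Rule (((x ^ α ∶ A) ∷ []) ⊢[ Ω ] fwd y x ∷ (y ^ β ∶ A)) []
    Cut : ∀ {ω Ω x P Q y β C w A} → FreshCh w Ω →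
          Rule (ω ⊢[ Ω ] cut x P Q ∷ (y ^ β ∶ C))
               ((ω ⊢[ Ω ∪ r A w ((y ^ β ∶ C) ∷ []) ] subst1 w x P ∷ (w ^ 0 ∶ A))
              ∷ (((w ^ 0 ∶ A) ∷ []) ⊢[ Ω ∪ r A w ω ] subst1 w x Q ∷ (y ^ β ∶ C))
              ∷ [])
    ⊕R  : ∀ {ω Ω y β k P As Ak} → (k , Ak) ∈ As →
          Rule (ω ⊢[ Ω ] sendR y k P ∷ (y ^ β ∶ ⊕ As))
               ((ω ⊢[ Ω ] P ∷ (y ^ β ∶ Ak)) ∷ [])
    ⊕L  : ∀ {x α As Ω bs z} → map proj₁ bs ≡ map proj₁ As →
          Rule (((x ^ α ∶ ⊕ As) ∷ []) ⊢[ Ω ] caseL x bs ∷ z)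
               (zipWith (λ b a → ((x ^ α ∶ proj₂ a) ∷ []) ⊢[ Ω ] proj₂ b ∷ z) bs As)
    &R  : ∀ {ω Ω y β As bs} → map proj₁ bs ≡ map proj₁ As →
          Rule (ω ⊢[ Ω ] caseR y bs ∷ (y ^ β ∶ & As))
               (zipWith (λ b a → ω ⊢[ Ω ] proj₂ b ∷ (y ^ β ∶ proj₂ a)) bs As)
    &L  : ∀ {x α As Ak k Ω P z} → (k , Ak) ∈ As →
          Rule (((x ^ α ∶ & As) ∷ []) ⊢[ Ω ] sendL x k P ∷ z)
               ((((x ^ α ∶ Ak) ∷ []) ⊢[ Ω ] P ∷ z) ∷ [])
    𝟙R  : ∀ {Ω y β} → Rule ([] ⊢[ Ω ] closeR y ∷ (y ^ β ∶ 𝟙)) []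
    𝟙L  : ∀ {x α Ω P z} →
          Rule (((x ^ α ∶ 𝟙) ∷ []) ⊢[ Ω ] waitL x P ∷ z)
               (([] ⊢[ Ω ] P ∷ z) ∷ [])
    μR′ : ∀ {ω Ω y β t p A P} → tdef t μ p A ∈ Sg → NewGen y (suc β) Ω →
          Rule (ω ⊢[ Ω ] μR y t P ∷ (y ^ β ∶ tv t))
               ((ω ⊢[ Ω ∪ eqs y β (suc β) p ] P ∷ (y ^ suc β ∶ A)) ∷ [])
    μL′ : ∀ {x α Ω t p A P z} → tdef t μ p A ∈ Sg → NewGen x (suc α) Ω →
          Rule (((x ^ α ∶ tv t) ∷ []) ⊢[ Ω ] μL x t P ∷ z)
               ((((x ^ suc α ∶ A) ∷ [])
                   ⊢[ Ω ∪ lt1 x (suc α) α p ∪ eqs x (suc α) α p ] P ∷ z) ∷ [])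
    νR′ : ∀ {ω Ω y β t p A P} → tdef t ν p A ∈ Sg → NewGen y (suc β) Ω →
          Rule (ω ⊢[ Ω ] νR y t P ∷ (y ^ β ∶ tv t))
               ((ω ⊢[ Ω ∪ lt1 y (suc β) β p ∪ eqs y (suc β) β p ] P ∷ (y ^ suc β ∶ A)) ∷ [])
    νL′ : ∀ {x α Ω t p A P z} → tdef t ν p A ∈ Sg → NewGen x (suc α) Ω →
          Rule (((x ^ α ∶ tv t) ∷ []) ⊢[ Ω ] νL x t P ∷ z)
               ((((x ^ suc α ∶ A) ∷ []) ⊢[ Ω ∪ eqs x (suc α) α p ] P ∷ z) ∷ [])
    Def : ∀ {ω Ω y β C X xs' y' body} →
          (X , xs' , y' , body) ∈ V → length xs' ≡ length ω →
          (X , map Hyp.ty ω , C) ∈ S →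
          Rule (ω ⊢[ Ω ] call y X (map Hyp.ch ω) ∷ (y ^ β ∶ C))
               ((ω ⊢[ Ω ] ren (paramRen (zip xs' (map Hyp.ch ω)) y' y) body
                   ∷ (y ^ β ∶ C)) ∷ [])

  record Deriv (J : Judg) : Set₁ where
    coinductive
    field
      prems : List Judg
      rule  : Rule J prems
      subs  : All Deriv prems
  open Deriv public

  data Path {J : Judg} (D : Deriv J) : Judg → Set₁ where
    here  : Path D J
    there : ∀ {J' J''} (k : J' ∈ prems D) → Path (All.lookup (subs D) k) J'' → Path D J''

-- The relations <_Ω, ≤_Ω and =_Ω are defined by chains of constraints
-- drawn from Ω, so each of them is monotone in Ω: a chain over Ω is a
-- chain over any larger set of constraints.  Inspecting the rules of the
-- infinitary generational system, no rule ever removes a constraint: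
-- every premise carries Ω itself (⊕, &, 1, Id, Def) or Ω extended by a
-- union (Cut, μR, μL, νR, νL).  Hence the constraint set only grows
-- from a judgment to each of its premises, and by induction along a
-- path it grows from the root of the path to its end.  The theorem is
-- then the monotonicity of the three chain relations applied to this
-- inclusion.

module Submission where

open import Defs
open import Data.Nat using (ℕ; _≤_)
open import Data.Product using (_×_; _,_)
open import Data.Sum using (inj₁)
open import Data.List using (List; _∷_; zipWith)
open import Data.List.Membership.Propositional using (_∈_)
open import Data.List.Relation.Unary.Any using (here; there)
open import Relation.Binary.PropositionalEquality using (refl)
open import Relation.Unary using (_⊆_)

∈-zipWith-all : ∀ {a b c p} {A : Set a} {B : Set b} {C : Set c}
                (P : C → Set p) (f : A → B → C) → (∀ x y → P (f x y)) →
                ∀ (xs : List A) (ys : List B) {z : C} → z ∈ zipWith f xs ys → P z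
∈-zipWith-all P f Pf (x ∷ xs) (y ∷ ys) (here refl) = Pf x y
∈-zipWith-all P f Pf (x ∷ xs) (y ∷ ys) (there z∈) = ∈-zipWith-all P f Pf xs ys z∈

≤-mono : ∀ {Ω Ω' a b} → Ω ⊆ Ω' → a ≤[ Ω ] b → a ≤[ Ω' ] b
≤-mono Ω⊆Ω' ≤-refl          = ≤-refl
≤-mono Ω⊆Ω' (≤-eq→ a≤b b=d) = ≤-eq→ (≤-mono Ω⊆Ω' a≤b) (Ω⊆Ω' b=d)
≤-mono Ω⊆Ω' (≤-eq← a≤b d=b) = ≤-eq← (≤-mono Ω⊆Ω' a≤b) (Ω⊆Ω' d=b)
≤-mono Ω⊆Ω' (≤-lt a≤b b<d)  = ≤-lt (≤-mono Ω⊆Ω' a≤b) (Ω⊆Ω' b<d)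

<-mono : ∀ {Ω Ω' a b} → Ω ⊆ Ω' → a <[ Ω ] b → a <[ Ω' ] b
<-mono Ω⊆Ω' (chain< a≤b b<b' b'≤d) =
  chain< (≤-mono Ω⊆Ω' a≤b) (Ω⊆Ω' b<b') (≤-mono Ω⊆Ω' b'≤d)

=-mono : ∀ {Ω Ω' a b} → Ω ⊆ Ω' → a =[ Ω ] b → a =[ Ω' ] b
=-mono Ω⊆Ω' =-refl          = =-refl
=-mono Ω⊆Ω' (=-eq→ a=b b=d) = =-eq→ (=-mono Ω⊆Ω' a=b) (Ω⊆Ω' b=d)
=-mono Ω⊆Ω' (=-eq← a=b d=b) = =-eq← (=-mono Ω⊆Ω' a=b) (Ω⊆Ω' d=b)

module _ (Sg : Signature) (Pg : Program) where
  open Rules Sg Pg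

  Extends : Judg → Judg → Set
  Extends J J' = Judg.Ω J ⊆ Judg.Ω J'

  rule-extends : ∀ {J Js J'} → Rule J Js → J' ∈ Js → Extends J J'
  rule-extends (Cut _)      (here refl)         = inj₁
  rule-extends (Cut _)      (there (here refl)) = inj₁
  rule-extends (⊕R _)       (here refl)         = λ k∈Ω → k∈Ω
  rule-extends (⊕L {_} {_} {As} {Ω} {bs} _) =
    ∈-zipWith-all (λ J' → Ω ⊆ Judg.Ω J') _ (λ _ _ k∈Ω → k∈Ω) bs As
  rule-extends (&R {_} {Ω} {_} {_} {As} {bs} _) =
    ∈-zipWith-all (λ J' → Ω ⊆ Judg.Ω J') _ (λ _ _ k∈Ω → k∈Ω) bs As
  rule-extends (&L _)       (here refl)         = λ k∈Ω → k∈Ω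
  rule-extends 𝟙L           (here refl)         = λ k∈Ω → k∈Ω
  rule-extends (μR′ _ _)    (here refl)         = inj₁
  rule-extends (μL′ _ _)    (here refl)         = λ k∈Ω → inj₁ (inj₁ k∈Ω)
  rule-extends (νR′ _ _)    (here refl)         = λ k∈Ω → inj₁ (inj₁ k∈Ω)
  rule-extends (νL′ _ _)    (here refl)         = inj₁
  rule-extends (Def _ _ _)  (here refl)         = λ k∈Ω → k∈Ω

  path-extends : ∀ {J J'} (D : Deriv J) → Path D J' → Extends J J'
  path-extends D here             = λ k∈Ω → k∈Ω
  path-extends D (there J∈ rest) k∈Ω =
    path-extends _ rest (rule-extends (rule D) J∈ k∈Ω)

mainTheorem6 : (Sg : Signature) (Pg : Program) {J J' : Judg}
               (D : Rules.Deriv Sg Pg J) → Rules.Path Sg Pg D J' →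
               ∀ (u v : Chan) (η η' i j : ℕ) → i ≤ maxPri Sg → j ≤ maxPri Sg →
               ((sym u η i <[ Judg.Ω J ] sym v η' j → sym u η i <[ Judg.Ω J' ] sym v η' j)
               × (sym u η i ≤[ Judg.Ω J ] sym v η' j → sym u η i ≤[ Judg.Ω J' ] sym v η' j)
               × (sym u η i =[ Judg.Ω J ] sym v η' j → sym u η i =[ Judg.Ω J' ] sym v η' j))
mainTheorem6 Sg Pg {J} {J'} D path u v η η' i j _ _ =
  <-mono Ω⊆Ω' , ≤-mono Ω⊆Ω' , =-mono Ω⊆Ω'
  where
    Ω⊆Ω' : Judg.Ω J ⊆ Judg.Ω J'
    Ω⊆Ω' = path-extends Sg Pg D path
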